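{- Let $f(x) = 1 + h_1x + h_2x^2 + \cdots$ be the unique power series with all $h_n \in \{1,2\}$ ($n \ge 1$) that is the square of an element of $R$, and set $h_0 = 1$. Then the sequence $(h_n)_{n \ge 0}$ is not periodic: there is no integer $\pi \ge 1$ with $h_{n+\pi} = h_n$ for all $n \ge 0$.
   Context: $R := 1 + x\mathbb{Z}[[x]]$ is the set of formal power series with integer coefficients and constant term $1$. -}

module Defs where

open import Data.Nat using (ℕ; zero; suc; _∸_)
open import Data.Integer using (ℤ; +_; _+_; _*_)
open import Data.Product using (Σ; _×_)
open import Relation.Binary.PropositionalEquality using (_≡_)

PowerSeries : Set
PowerSeries = ℕ → ℤ

sumUpTo : ℕ → (ℕ → ℤ) → ℤ
sumUpTo zero    f = f 0
sumUpTo (suc n) f = sumUpTo n f + f (suc n)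

_·_ : PowerSeries → PowerSeries → PowerSeries
(f · g) n = sumUpTo n (λ i → f i * g (n ∸ i))

-- Membership in R = 1 + xℤ[[x]]
InR : PowerSeries → Set
InR g = g 0 ≡ + 1

IsSquareInR : PowerSeries → Set
IsSquareInR f = Σ PowerSeries (λ g → InR g × (∀ n → (g · g) n ≡ f n))

{-# OPTIONS --safe #-}
module Submission where

-- Let b be the 0/1 reduction of g mod 2, so that h = g² ≡ b² (mod 4). Modulo 2 the cross terms
-- of b² cancel in pairs: b²₂ₘ ≡ bₘ and b²₂ₘ₊₁ ≡ 0. As every hₙ lies in {1, 2}, this forces
-- h₂ₘ = 2 - bₘ and h₂ₘ₊₁ = 2, so a period p of h is a period of b, and then p + p is one of h.
-- For a p-periodic b the differences Δₙ = b²ₙ₊ₚ - b²ₙ are p-periodic, so comparing h with b² at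
-- n and n + 2p gives 2Δₙ ≡ 0 (mod 4), i.e. b² is p-periodic mod 2. For odd p this contradicts
-- b²ₚ ≡ 0, b²₀ = 1; for p = 2r it makes r a period of b, and the descent cannot go on forever.

open import Defs
open import Data.Empty using (⊥-elim)
open import Data.Integer as ℤ using (ℤ; +_; _-_; _*_; ∣_∣)
open import Data.Integer.DivMod using (_%ℕ_; _/ℕ_; a≡a%ℕn+[a/ℕn]*n; n%ℕd<d)
open import Data.Integer.Divisibility.Signed
  using (_∣_; divides; quotient; ∣-trans; ∣m∣n⇒∣m+n; ∣m⇒∣-m; *-cancelˡ-∣; ∣⇒∣ᵤ)
import Data.Integer.Properties as ℤ
open import Data.Integer.Tactic.RingSolver using (solve-∀)
open import Data.Nat using (ℕ; zero; suc; _+_; _∸_; _≤_; _<_; z≤n; s≤s; z<s)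
import Data.Nat.Divisibility as ℕ
open import Data.Nat.Induction using (<-rec)
open import Data.Nat.Properties
  using ( +-assoc; +-comm; +-suc; +-identityʳ; +-commutativeSemigroup; ≤-refl; m≤n⇒m≤1+n; m≤n⇒m≤o+n
        ; m<m+n; n≮0; +-∸-assoc; +-∸-comm; m∸[m∸n]≡n; n∸n≡0; m+n∸n≡m; [m+n]∸[m+o]≡n∸o )
import Algebra.Properties.CommutativeSemigroup as CommutativeSemigroupProperties
open CommutativeSemigroupProperties +-commutativeSemigroup
  using () renaming (interchange to +-interchange)
open CommutativeSemigroupProperties ℤ.+-commutativeSemigroup
  using () renaming (interchange to ℤ+-interchange)
open import Data.Product using (Σ; _×_; _,_)
open import Data.Sum using (_⊎_; inj₁; inj₂)
open import Function.Base using (_∘_)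
open import Level using (0ℓ)
open import Relation.Binary.Bundles using (Setoid)
open import Relation.Binary.Structures using (IsEquivalence)
import Relation.Binary.Reasoning.Setoid as SetoidReasoning
open import Relation.Nullary using (¬_)
open import Relation.Binary.PropositionalEquality using (_≡_; refl; sym; trans; cong; cong₂; subst; module ≡-Reasoning)

-- A record rather than a synonym for m ∣ x - y, so that x and y can be inferred from the type.
infix 4 _≡_mod_
record _≡_mod_ (x y m : ℤ) : Set where
  constructor congruent
  field m∣x-y : m ∣ x - y
open _≡_mod_ using (m∣x-y)

≡-mod-refl : ∀ {m x} → x ≡ x mod m
≡-mod-refl {x = x} = congruent (divides (+ 0) (ℤ.+-inverseʳ x))

≡-mod-sym : ∀ {m x y} → x ≡ y mod m → y ≡ x mod m
≡-mod-sym {m} {x} {y} (congruent m∣x-y) = congruent (subst (m ∣_) (neg-minus x y) (∣m⇒∣-m m∣x-y))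
  where
  neg-minus : ∀ x y → ℤ.- (x - y) ≡ y - x
  neg-minus = solve-∀

≡-mod-trans : ∀ {m x y z} → x ≡ y mod m → y ≡ z mod m → x ≡ z mod m
≡-mod-trans {m} {x} {y} {z} (congruent m∣x-y) (congruent m∣y-z) =
  congruent (subst (m ∣_) (ℤ.+-minus-telescope x y z) (∣m∣n⇒∣m+n m∣x-y m∣y-z))

≡-mod-isEquivalence : ∀ m → IsEquivalence (λ x y → x ≡ y mod m)
≡-mod-isEquivalence m = record { refl = ≡-mod-refl ; sym = ≡-mod-sym ; trans = ≡-mod-trans }

≡-mod-setoid : ℤ → Setoid 0ℓ 0ℓ
≡-mod-setoid m = record { isEquivalence = ≡-mod-isEquivalence m }

module ≡-mod-Reasoning (m : ℤ) = SetoidReasoning (≡-mod-setoid m)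

x+k*m≡x : ∀ x k m → x ℤ.+ k * m ≡ x mod m
x+k*m≡x x k m = congruent (divides k (cancel x (k * m)))
  where
  cancel : ∀ x y → x ℤ.+ y - x ≡ y
  cancel = solve-∀

≡-mod⇒≡+k*m : ∀ {m x y} (x≡y : x ≡ y mod m) → x ≡ y ℤ.+ quotient (m∣x-y x≡y) * m
≡-mod⇒≡+k*m {m} {x} {y} (congruent (divides k x-y≡k*m)) = trans (split x y) (cong (ℤ._+_ y) x-y≡k*m)
  where
  split : ∀ x y → x ≡ y ℤ.+ (x - y)
  split = solve-∀

∣x∣≡1⇒2∤x : ∀ {x} → ∣ x ∣ ≡ 1 → ¬ (+ 2 ∣ x)
∣x∣≡1⇒2∤x ∣x∣≡1 2∣x = ℕ.>⇒∤ ≤-refl (subst (2 ℕ.∣_) ∣x∣≡1 (∣⇒∣ᵤ 2∣x))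

Bit : ℤ → Set
Bit x = x ≡ + 0 ⊎ x ≡ + 1

OneOrTwo : ℤ → Set
OneOrTwo x = x ≡ + 1 ⊎ x ≡ + 2

bit : ℤ → ℤ
bit x = + (x %ℕ 2)

bit-Bit : ∀ x → Bit (bit x)
bit-Bit x with x %ℕ 2 | n%ℕd<d x 2
... | 0           | _                 = inj₁ refl
... | 1           | _                 = inj₂ refl
... | suc (suc _) | s≤s (s≤s ())

x≡bit-x : ∀ x → x ≡ bit x mod + 2
x≡bit-x x = subst (_≡ bit x mod + 2) (sym (a≡a%ℕn+[a/ℕn]*n x 2)) (x+k*m≡x (bit x) (x /ℕ 2) (+ 2))

Bit-idempotent : ∀ {x} → Bit x → x * x ≡ x
Bit-idempotent (inj₁ refl) = refl
Bit-idempotent (inj₂ refl) = refl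

Bit-≡-mod-2⇒≡ : ∀ {x y} → Bit x → Bit y → x ≡ y mod + 2 → x ≡ y
Bit-≡-mod-2⇒≡ (inj₁ refl) (inj₁ refl) _                  = refl
Bit-≡-mod-2⇒≡ (inj₂ refl) (inj₂ refl) _                  = refl
Bit-≡-mod-2⇒≡ (inj₁ refl) (inj₂ refl) (congruent 2∣-1) = ⊥-elim (∣x∣≡1⇒2∤x refl 2∣-1)
Bit-≡-mod-2⇒≡ (inj₂ refl) (inj₁ refl) (congruent 2∣1)  = ⊥-elim (∣x∣≡1⇒2∤x refl 2∣1)

OneOrTwo-≡-Bit-mod-2 : ∀ {x y} → OneOrTwo x → Bit y → x ≡ y mod + 2 → x ≡ + 2 - y
OneOrTwo-≡-Bit-mod-2 (inj₁ refl) (inj₂ refl) _                = refl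
OneOrTwo-≡-Bit-mod-2 (inj₂ refl) (inj₁ refl) _                = refl
OneOrTwo-≡-Bit-mod-2 (inj₁ refl) (inj₁ refl) (congruent 2∣1) = ⊥-elim (∣x∣≡1⇒2∤x refl 2∣1)
OneOrTwo-≡-Bit-mod-2 (inj₂ refl) (inj₂ refl) (congruent 2∣1) = ⊥-elim (∣x∣≡1⇒2∤x refl 2∣1)

sumUpTo-cong : ∀ n {f g : ℕ → ℤ} → (∀ i → i ≤ n → f i ≡ g i) → sumUpTo n f ≡ sumUpTo n g
sumUpTo-cong zero    f≗g = f≗g 0 z≤n
sumUpTo-cong (suc n) f≗g =
  cong₂ ℤ._+_ (sumUpTo-cong n (λ i i≤n → f≗g i (m≤n⇒m≤1+n i≤n))) (f≗g (suc n) ≤-refl)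

sumUpTo-split : ∀ k n (f : ℕ → ℤ) →
                sumUpTo (suc (k + n)) f ≡ sumUpTo k f ℤ.+ sumUpTo n (λ i → f (suc (k + i)))
sumUpTo-split k zero    f rewrite +-identityʳ k = refl
sumUpTo-split k (suc n) f rewrite +-suc k n =
  trans (cong (ℤ._+ f (suc (suc (k + n)))) (sumUpTo-split k n f))
        (ℤ.+-assoc (sumUpTo k f) (sumUpTo n (λ i → f (suc (k + i)))) (f (suc (suc (k + n)))))

sumUpTo-reverse : ∀ n (f : ℕ → ℤ) → sumUpTo n f ≡ sumUpTo n (λ i → f (n ∸ i))
sumUpTo-reverse zero    f = refl
sumUpTo-reverse (suc n) f = begin
  sumUpTo (suc n) f                          ≡⟨ sumUpTo-split 0 n f ⟩
  f 0 ℤ.+ sumUpTo n (f ∘ suc)                ≡⟨ cong (ℤ._+_ (f 0)) (sumUpTo-reverse n (f ∘ suc)) ⟩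
  f 0 ℤ.+ sumUpTo n (λ i → f (suc (n ∸ i)))  ≡⟨ ℤ.+-comm (f 0) _ ⟩
  sumUpTo n (λ i → f (suc (n ∸ i))) ℤ.+ f 0  ≡⟨ cong₂ ℤ._+_ (sumUpTo-cong n (λ i i≤n → cong f (sym (+-∸-assoc 1 i≤n))))
                                                           (cong f (sym (n∸n≡0 n))) ⟩
  sumUpTo (suc n) (λ i → f (suc n ∸ i))      ∎
  where open ≡-Reasoning

sumUpTo-+ : ∀ n (f g : ℕ → ℤ) → sumUpTo n (λ i → f i ℤ.+ g i) ≡ sumUpTo n f ℤ.+ sumUpTo n g
sumUpTo-+ zero    f g = refl
sumUpTo-+ (suc n) f g =
  trans (cong (ℤ._+ (f (suc n) ℤ.+ g (suc n))) (sumUpTo-+ n f g))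
        (ℤ+-interchange (sumUpTo n f) (sumUpTo n g) (f (suc n)) (g (suc n)))

sumUpTo-*ʳ : ∀ n (f : ℕ → ℤ) c → sumUpTo n (λ i → f i * c) ≡ sumUpTo n f * c
sumUpTo-*ʳ zero    f c = refl
sumUpTo-*ʳ (suc n) f c =
  trans (cong (ℤ._+ f (suc n) * c) (sumUpTo-*ʳ n f c))
        (sym (ℤ.*-distribʳ-+ c (sumUpTo n f) (f (suc n))))

·-comm : ∀ (f g : PowerSeries) n → (f · g) n ≡ (g · f) n
·-comm f g n = trans (sumUpTo-reverse n _) (sumUpTo-cong n swap)
  where
  swap : ∀ i → i ≤ n → f (n ∸ i) * g (n ∸ (n ∸ i)) ≡ g i * f (n ∸ i)
  swap i i≤n = trans (cong (λ j → f (n ∸ i) * g j) (m∸[m∸n]≡n i≤n)) (ℤ.*-comm (f (n ∸ i)) (g i))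

·-square-expansion : ∀ {f g c : PowerSeries} k → (∀ i → f i ≡ g i ℤ.+ c i * k) → ∀ n →
                     (f · f) n ≡ (g · g) n ℤ.+ ((g · c) n ℤ.+ (c · g) n) * k ℤ.+ (c · c) n * (k * k)
·-square-expansion {f} {g} {c} k f≡g+ck n = begin
  (f · f) n
    ≡⟨ sumUpTo-cong n (λ i _ → expand-term i) ⟩
  sumUpTo n (λ i → gg i ℤ.+ (gc i ℤ.+ cg i) * k ℤ.+ cc i * (k * k))
    ≡⟨ sumUpTo-+ n _ _ ⟩
  sumUpTo n (λ i → gg i ℤ.+ (gc i ℤ.+ cg i) * k) ℤ.+ sumUpTo n (λ i → cc i * (k * k))
    ≡⟨ cong₂ ℤ._+_ (sumUpTo-+ n _ _) (sumUpTo-*ʳ n cc (k * k)) ⟩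
  (g · g) n ℤ.+ sumUpTo n (λ i → (gc i ℤ.+ cg i) * k) ℤ.+ (c · c) n * (k * k)
    ≡⟨ cong (λ s → (g · g) n ℤ.+ s ℤ.+ (c · c) n * (k * k))
            (trans (sumUpTo-*ʳ n _ k) (cong (_* k) (sumUpTo-+ n gc cg))) ⟩
  (g · g) n ℤ.+ ((g · c) n ℤ.+ (c · g) n) * k ℤ.+ (c · c) n * (k * k)
    ∎
  where
  open ≡-Reasoning
  gg gc cg cc : ℕ → ℤ
  gg i = g i * g (n ∸ i)
  gc i = g i * c (n ∸ i)
  cg i = c i * g (n ∸ i)
  cc i = c i * c (n ∸ i)

  expand : ∀ k a b a′ b′ →
           (a ℤ.+ b * k) * (a′ ℤ.+ b′ * k) ≡ a * a′ ℤ.+ (a * b′ ℤ.+ b * a′) * k ℤ.+ b * b′ * (k * k)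
  expand = solve-∀

  expand-term : ∀ i → f i * f (n ∸ i) ≡ gg i ℤ.+ (gc i ℤ.+ cg i) * k ℤ.+ cc i * (k * k)
  expand-term i = trans (cong₂ _*_ (f≡g+ck i) (f≡g+ck (n ∸ i))) (expand k (g i) (c i) (g (n ∸ i)) (c (n ∸ i)))

≡-mod-2⇒square-≡-mod-4 : ∀ {f g : PowerSeries} → (∀ i → f i ≡ g i mod + 2) →
                         ∀ n → (f · f) n ≡ (g · g) n mod + 4
≡-mod-2⇒square-≡-mod-4 {f} {g} f≡g n = begin
  (f · f) n                             ≡⟨ ·-square-expansion {f} {g} {c} (+ 2) f≡g+c*2 n ⟩
  gg ℤ.+ (gc ℤ.+ cg) * + 2 ℤ.+ cc * + 4  ≡⟨ cong (λ t → gg ℤ.+ (gc ℤ.+ t) * + 2 ℤ.+ cc * + 4) (·-comm c g n) ⟩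
  gg ℤ.+ (gc ℤ.+ gc) * + 2 ℤ.+ cc * + 4  ≡⟨ regroup gg gc cc ⟩
  gg ℤ.+ (gc ℤ.+ cc) * + 4               ≈⟨ x+k*m≡x gg (gc ℤ.+ cc) (+ 4) ⟩
  gg                                    ∎
  where
  open ≡-mod-Reasoning (+ 4)
  c : PowerSeries
  c i = quotient (m∣x-y (f≡g i))

  f≡g+c*2 : ∀ i → f i ≡ g i ℤ.+ c i * + 2
  f≡g+c*2 i = ≡-mod⇒≡+k*m (f≡g i)

  gg gc cg cc : ℤ
  gg = (g · g) n
  gc = (g · c) n
  cg = (c · g) n
  cc = (c · c) n

  regroup : ∀ a b d → a ℤ.+ (b ℤ.+ b) * + 2 ℤ.+ d * + 4 ≡ a ℤ.+ (b ℤ.+ d) * + 4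
  regroup = solve-∀

Palindromic : ℕ → (ℕ → ℤ) → Set
Palindromic n f = ∀ i → i ≤ n → f i ≡ f (n ∸ i)

Palindromic-inner : ∀ {n f} → Palindromic (suc (suc n)) f → Palindromic n (f ∘ suc)
Palindromic-inner {n} {f} pal i i≤n =
  trans (pal (suc i) (s≤s (m≤n⇒m≤1+n i≤n))) (cong f (+-∸-assoc 1 i≤n))

sumUpTo-Palindromic-peel : ∀ {n f} → Palindromic (suc (suc n)) f →
                           sumUpTo (suc (suc n)) f ≡ sumUpTo n (f ∘ suc) mod + 2
sumUpTo-Palindromic-peel {n} {f} pal = begin
  sumUpTo (suc n) f ℤ.+ f (suc (suc n))   ≡⟨ cong₂ ℤ._+_ (sumUpTo-split 0 n f) (sym (pal 0 z≤n)) ⟩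
  f 0 ℤ.+ sumUpTo n (f ∘ suc) ℤ.+ f 0      ≡⟨ rearrange (f 0) (sumUpTo n (f ∘ suc)) ⟩
  sumUpTo n (f ∘ suc) ℤ.+ f 0 * + 2        ≈⟨ x+k*m≡x (sumUpTo n (f ∘ suc)) (f 0) (+ 2) ⟩
  sumUpTo n (f ∘ suc)                      ∎
  where
  open ≡-mod-Reasoning (+ 2)
  rearrange : ∀ a s → a ℤ.+ s ℤ.+ a ≡ s ℤ.+ a * + 2
  rearrange = solve-∀

sumUpTo-Palindromic-even : ∀ m {f} → Palindromic (m + m) f → sumUpTo (m + m) f ≡ f m mod + 2
sumUpTo-Palindromic-even zero    pal = ≡-mod-refl
sumUpTo-Palindromic-even (suc m) pal rewrite +-suc m m =
  ≡-mod-trans (sumUpTo-Palindromic-peel pal) (sumUpTo-Palindromic-even m (Palindromic-inner pal))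

sumUpTo-Palindromic-odd : ∀ m {f} → Palindromic (suc (m + m)) f → sumUpTo (suc (m + m)) f ≡ + 0 mod + 2
sumUpTo-Palindromic-odd zero {f} pal = begin
  f 0 ℤ.+ f 1        ≡⟨ cong (ℤ._+_ (f 0)) (sym (pal 0 z≤n)) ⟩
  f 0 ℤ.+ f 0        ≡⟨ double (f 0) ⟩
  + 0 ℤ.+ f 0 * + 2  ≈⟨ x+k*m≡x (+ 0) (f 0) (+ 2) ⟩
  + 0                ∎
  where
  open ≡-mod-Reasoning (+ 2)
  double : ∀ a → a ℤ.+ a ≡ + 0 ℤ.+ a * + 2
  double = solve-∀
sumUpTo-Palindromic-odd (suc m) pal rewrite +-suc m m =
  ≡-mod-trans (sumUpTo-Palindromic-peel pal) (sumUpTo-Palindromic-odd m (Palindromic-inner pal))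

·-square-Palindromic : ∀ (f : PowerSeries) n → Palindromic n (λ i → f i * f (n ∸ i))
·-square-Palindromic f n i i≤n =
  trans (ℤ.*-comm (f i) (f (n ∸ i))) (cong (λ j → f (n ∸ i) * f j) (sym (m∸[m∸n]≡n i≤n)))

·-square-even-coeff : ∀ (f : PowerSeries) m → (f · f) (m + m) ≡ f m * f m mod + 2
·-square-even-coeff f m = begin
  (f · f) (m + m)          ≈⟨ sumUpTo-Palindromic-even m (·-square-Palindromic f (m + m)) ⟩
  f m * f (m + m ∸ m)      ≡⟨ cong (λ j → f m * f j) (m+n∸n≡m m m) ⟩
  f m * f m                ∎
  where open ≡-mod-Reasoning (+ 2)

·-square-odd-coeff : ∀ (f : PowerSeries) m → (f · f) (suc (m + m)) ≡ + 0 mod + 2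
·-square-odd-coeff f m = sumUpTo-Palindromic-odd m (·-square-Palindromic f (suc (m + m)))

Periodic : ℕ → PowerSeries → Set
Periodic p f = ∀ n → f (n + p) ≡ f n

Periodic-+ : ∀ {p q f} → Periodic p f → Periodic q f → Periodic (p + q) f
Periodic-+ {p} {q} {f} per-p per-q n =
  trans (cong f (sym (+-assoc n p q))) (trans (per-q (n + p)) (per-p n))

·-Periodic-difference : ∀ {p} {f g : PowerSeries} → Periodic p f → Periodic p g →
                        Periodic p (λ n → (f · g) (n + p) - (f · g) n)
·-Periodic-difference {zero}  {f} {g} _ _ n = cong (λ m → (f · g) (m + 0) - (f · g) m) (+-identityʳ n)
·-Periodic-difference {suc q} {f} {g} f-per g-per n = begin
  (f · g) (n + p + p) - (f · g) (n + p)  ≡⟨ difference (n + p) ⟩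
  head (n + p)                           ≡⟨ sumUpTo-cong q head-term-periodic ⟩
  head n                                 ≡⟨ difference n ⟨
  (f · g) (n + p) - (f · g) n            ∎
  where
  open ≡-Reasoning
  p : ℕ
  p = suc q
  head : ℕ → ℤ
  head m = sumUpTo q (λ i → f i * g (m + p ∸ i))

  shift : ∀ m → (f · g) (m + p) ≡ head m ℤ.+ (f · g) m
  shift m = begin
    sumUpTo (m + p) (λ i → f i * g (m + p ∸ i))
      ≡⟨ cong (λ t → sumUpTo t (λ i → f i * g (m + p ∸ i))) m+p≡1+q+m ⟩
    sumUpTo (suc (q + m)) (λ i → f i * g (m + p ∸ i))
      ≡⟨ sumUpTo-split q m _ ⟩
    head m ℤ.+ sumUpTo m (λ i → f (p + i) * g (m + p ∸ (p + i)))
      ≡⟨ cong (ℤ._+_ (head m)) (sumUpTo-cong m shift-term) ⟩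
    head m ℤ.+ (f · g) m
      ∎
    where
    m+p≡1+q+m : m + p ≡ suc (q + m)
    m+p≡1+q+m = trans (+-suc m q) (cong suc (+-comm m q))

    shift-term : ∀ i → i ≤ m → f (p + i) * g (m + p ∸ (p + i)) ≡ f i * g (m ∸ i)
    shift-term i _ = cong₂ _*_ (trans (cong f (+-comm p i)) (f-per i))
                               (cong g (trans (cong (_∸ (p + i)) (+-comm m p)) ([m+n]∸[m+o]≡n∸o p m i)))

  difference : ∀ m → (f · g) (m + p) - (f · g) m ≡ head m
  difference m = trans (cong (_- (f · g) m) (shift m)) (cancel (head m) ((f · g) m))
    where
    cancel : ∀ a b → a ℤ.+ b - b ≡ a
    cancel = solve-∀

  head-term-periodic : ∀ i → i ≤ q → f i * g (n + p + p ∸ i) ≡ f i * g (n + p ∸ i)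
  head-term-periodic i i≤q =
    cong (f i *_) (trans (cong g (+-∸-comm p (m≤n⇒m≤o+n n (m≤n⇒m≤1+n i≤q)))) (g-per (n + p ∸ i)))

data EvenOrOdd : ℕ → Set where
  even : ∀ m → EvenOrOdd (m + m)
  odd  : ∀ m → EvenOrOdd (suc (m + m))

evenOrOdd : ∀ n → EvenOrOdd n
evenOrOdd zero = even 0
evenOrOdd (suc n) with evenOrOdd n
... | even m = odd m
... | odd m  = subst EvenOrOdd (cong suc (+-suc m m)) (even (suc m))

module SquareWithCoefficientsOneOrTwo
  (g h : PowerSeries) (g∈R : InR g) (g²≡h : ∀ n → (g · g) n ≡ h n) (h∈12 : ∀ n → OneOrTwo (h n))
  where

  b : PowerSeries
  b = bit ∘ g

  h≡b²-mod-4 : ∀ n → h n ≡ (b · b) n mod + 4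
  h≡b²-mod-4 n = subst (_≡ (b · b) n mod + 4) (g²≡h n) (≡-mod-2⇒square-≡-mod-4 (x≡bit-x ∘ g) n)

  h≡b²-mod-2 : ∀ n → h n ≡ (b · b) n mod + 2
  h≡b²-mod-2 n = congruent (∣-trans (divides (+ 2) refl) (m∣x-y (h≡b²-mod-4 n)))

  b≡b²-even-mod-2 : ∀ m → b m ≡ (b · b) (m + m) mod + 2
  b≡b²-even-mod-2 m = begin
    b m              ≡⟨ Bit-idempotent (bit-Bit (g m)) ⟨
    b m * b m        ≈⟨ ·-square-even-coeff b m ⟨
    (b · b) (m + m)  ∎
    where open ≡-mod-Reasoning (+ 2)

  b≡h-even-mod-2 : ∀ m → b m ≡ h (m + m) mod + 2
  b≡h-even-mod-2 m = ≡-mod-trans (b≡b²-even-mod-2 m) (≡-mod-sym (h≡b²-mod-2 (m + m)))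

  h-even : ∀ m → h (m + m) ≡ + 2 - b m
  h-even m = OneOrTwo-≡-Bit-mod-2 (h∈12 (m + m)) (bit-Bit (g m)) (≡-mod-sym (b≡h-even-mod-2 m))

  h-odd : ∀ m → h (suc (m + m)) ≡ + 2
  h-odd m = OneOrTwo-≡-Bit-mod-2 (h∈12 (suc (m + m))) (inj₁ refl)
                                 (≡-mod-trans (h≡b²-mod-2 (suc (m + m))) (·-square-odd-coeff b m))

  b-Periodic⇒h-Periodic : ∀ {p} → Periodic p b → Periodic (p + p) h
  b-Periodic⇒h-Periodic {p} b-per n with evenOrOdd n
  ... | even m = begin
    h (m + m + (p + p))        ≡⟨ cong h (+-interchange m m p p) ⟩
    h (m + p + (m + p))        ≡⟨ h-even (m + p) ⟩
    + 2 - b (m + p)            ≡⟨ cong (+ 2 -_) (b-per m) ⟩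
    + 2 - b m                  ≡⟨ h-even m ⟨
    h (m + m)                  ∎
    where open ≡-Reasoning
  ... | odd m = begin
    h (suc (m + m + (p + p)))  ≡⟨ cong (h ∘ suc) (+-interchange m m p p) ⟩
    h (suc (m + p + (m + p)))  ≡⟨ h-odd (m + p) ⟩
    + 2                        ≡⟨ h-odd m ⟨
    h (suc (m + m))            ∎
    where open ≡-Reasoning

  h-Periodic⇒b-Periodic : ∀ {p} → Periodic p h → Periodic p b
  h-Periodic⇒b-Periodic {p} h-per m = Bit-≡-mod-2⇒≡ (bit-Bit (g (m + p))) (bit-Bit (g m)) (begin
    b (m + p)                  ≈⟨ b≡h-even-mod-2 (m + p) ⟩
    h (m + p + (m + p))        ≡⟨ cong h (+-interchange m p m p) ⟩
    h (m + m + (p + p))        ≡⟨ Periodic-+ h-per h-per (m + m) ⟩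
    h (m + m)                  ≈⟨ b≡h-even-mod-2 m ⟨
    b m                        ∎)
    where open ≡-mod-Reasoning (+ 2)

  b-Periodic⇒b²-Periodic-mod-2 : ∀ {p} → Periodic p b → ∀ n → (b · b) (n + p) ≡ (b · b) n mod + 2
  b-Periodic⇒b²-Periodic-mod-2 {p} b-per n =
    congruent (*-cancelˡ-∣ (+ 2) (subst (+ 4 ∣_) two-steps (m∣x-y ≡-mod-4)))
    where
    Δ : ℕ → ℤ
    Δ k = (b · b) (k + p) - (b · b) k

    two-steps : (b · b) (n + (p + p)) - (b · b) n ≡ + 2 * Δ n
    two-steps = begin
      (b · b) (n + (p + p)) - (b · b) n  ≡⟨ cong (λ j → (b · b) j - (b · b) n) (sym (+-assoc n p p)) ⟩
      (b · b) (n + p + p) - (b · b) n    ≡⟨ ℤ.+-minus-telescope ((b · b) (n + p + p)) ((b · b) (n + p)) ((b · b) n) ⟨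
      Δ (n + p) ℤ.+ Δ n                  ≡⟨ cong (ℤ._+ Δ n) (·-Periodic-difference b-per b-per n) ⟩
      Δ n ℤ.+ Δ n                        ≡⟨ double (Δ n) ⟩
      + 2 * Δ n                          ∎
      where
      open ≡-Reasoning
      double : ∀ x → x ℤ.+ x ≡ + 2 * x
      double = solve-∀

    ≡-mod-4 : (b · b) (n + (p + p)) ≡ (b · b) n mod + 4
    ≡-mod-4 = begin
      (b · b) (n + (p + p))  ≈⟨ h≡b²-mod-4 (n + (p + p)) ⟨
      h (n + (p + p))        ≡⟨ b-Periodic⇒h-Periodic b-per n ⟩
      h n                    ≈⟨ h≡b²-mod-4 n ⟩
      (b · b) n              ∎
      where open ≡-mod-Reasoning (+ 4)

  b-not-odd-Periodic : ∀ r → ¬ Periodic (suc (r + r)) b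
  b-not-odd-Periodic r b-per = ∣x∣≡1⇒2∤x refl (m∣x-y 0≡1-mod-2)
    where
    0≡1-mod-2 : + 0 ≡ + 1 mod + 2
    0≡1-mod-2 = begin
      + 0                    ≈⟨ ·-square-odd-coeff b r ⟨
      (b · b) (suc (r + r))  ≈⟨ b-Periodic⇒b²-Periodic-mod-2 b-per 0 ⟩
      (b · b) 0              ≈⟨ b≡b²-even-mod-2 0 ⟨
      b 0                    ≡⟨ cong bit g∈R ⟩
      + 1                    ∎
      where open ≡-mod-Reasoning (+ 2)

  b-Periodic⇒b-half-Periodic : ∀ {r} → Periodic (r + r) b → Periodic r b
  b-Periodic⇒b-half-Periodic {r} b-per k = Bit-≡-mod-2⇒≡ (bit-Bit (g (k + r))) (bit-Bit (g k)) (begin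
    b (k + r)                  ≈⟨ b≡b²-even-mod-2 (k + r) ⟩
    (b · b) (k + r + (k + r))  ≡⟨ cong (b · b) (+-interchange k r k r) ⟩
    (b · b) (k + k + (r + r))  ≈⟨ b-Periodic⇒b²-Periodic-mod-2 b-per (k + k) ⟩
    (b · b) (k + k)            ≈⟨ b≡b²-even-mod-2 k ⟨
    b k                        ∎)
    where open ≡-mod-Reasoning (+ 2)

  b-aperiodic : ∀ p → 1 ≤ p → ¬ Periodic p b
  b-aperiodic = <-rec (λ p → 1 ≤ p → ¬ Periodic p b) descend
    where
    descend : ∀ p → (∀ {r} → r < p → 1 ≤ r → ¬ Periodic r b) → 1 ≤ p → ¬ Periodic p b
    descend p smaller 1≤p b-per with evenOrOdd p
    ... | odd r        = b-not-odd-Periodic r b-per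
    ... | even zero    = n≮0 1≤p
    ... | even (suc r) = smaller (m<m+n (suc r) z<s) (s≤s z≤n) (b-Periodic⇒b-half-Periodic b-per)

  h-aperiodic : ∀ p → 1 ≤ p → ¬ Periodic p h
  h-aperiodic p 1≤p = b-aperiodic p 1≤p ∘ h-Periodic⇒b-Periodic

corollary21 : (h : PowerSeries) → h 0 ≡ + 1
              → (∀ n → 1 ≤ n → h n ≡ + 1 ⊎ h n ≡ + 2)
              → IsSquareInR h
              → ¬ (Σ ℕ (λ π → 1 ≤ π × (∀ n → h (n + π) ≡ h n)))
corollary21 h h0 h12 (g , g∈R , g²≡h) (π , 1≤π , h-per) =
  SquareWithCoefficientsOneOrTwo.h-aperiodic g h g∈R g²≡h h∈12 π 1≤π h-per
  where
  h∈12 : ∀ n → OneOrTwo (h n)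
  h∈12 zero    = inj₁ h0
  h∈12 (suc n) = h12 (suc n) (s≤s z≤n)
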